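{- Let $R$ be a dedekind type domain, let $\mathit{M}(R)$ be the monoid of ideals generated by the maximal ideals of $R$, let $k\geq 2$, and let $\mathcal{I}_1,\dots,\mathcal{I}_k\in\mathit{M}(R)$ be pairwise comaximal ideals. Then the maps $$\sigma_1,\sigma_2:SL_k(R)\to\mathbb{PF}^{k-1}_{\mathcal{I}_1}\times\cdots\times\mathbb{PF}^{k-1}_{\mathcal{I}_k}$$ given, for $A=[a_{ij}]$ with $\det A=1$, by $\sigma_1(A)=([a_{11}:\dots:a_{1k}],\dots,[a_{k1}:\dots:a_{kk}])$ (rows) and $\sigma_2(A)=([a_{11}:\dots:a_{k1}],\dots,[a_{1k}:\dots:a_{kk}])$ (columns) are surjective.
   Context: A commutative ring $R$ with unity is a dedekind type domain if it is a field, or if every maximal ideal $\mathcal{M}$ satisfies: (1) $\mathcal{M}^i\neq\mathcal{M}^{i+1}$ for all $i\ge0$; (2) $\bigcap_{i\ge0}\mathcal{M}^i=(0)$; (3) $\dim_{R/\mathcal{M}}(\mathcal{M}^i/\mathcal{M}^{i+1})=1$ for all $i\geq 0$; and moreover (4) every nonzero element of $R$ lies in only finitely many maximal ideals. $\mathit{M}(R)$ is the set of finite products of maximal ideals (including $R$ as the empty product). A tuple $(a_0,\dots,a_n)\in R^{n+1}$ is unital if $(a_0,\dots,a_n)=R$. For an ideal $\mathcal{I}\in\mathit{M}(R)$, on unital tuples in $R^{n+1}$ set $(a_i)\sim(b_i)$ iff $a_ib_j-a_jb_i\in\mathcal{I}$ for all $i<j$ (an equivalence relation); $[a_0:\dots:a_n]$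 denotes the class and $\mathbb{PF}^n_{\mathcal{I}}$ the set of classes. -}

module Defs where

open import Level using (Level; _⊔_)
open import Algebra.Bundles using (CommutativeRing)
open import Data.Nat using (ℕ; zero; suc)
open import Data.Fin using (Fin; zero; suc; punchIn; _<_)
open import Data.Product using (Σ; ∃; _×_; _,_)
open import Data.Sum using (_⊎_)
open import Data.List using (List)
open import Data.List.Relation.Unary.Any using (Any)
open import Data.Unit.Polymorphic using (⊤)
open import Relation.Nullary using (¬_)

module _ {c ℓ : Level} (R : CommutativeRing c ℓ) where
  open CommutativeRing R hiding (zero)

  Subset : Set (Level.suc (c ⊔ ℓ))
  Subset = Carrier → Set (c ⊔ ℓ)

  infixl 6 _−_
  _−_ : Carrier → Carrier → Carrier
  x − y = x + (- y)

  _⊆_ : Subset → Subset → Set (c ⊔ ℓ)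
  I ⊆ J = ∀ x → I x → J x

  _≐_ : Subset → Subset → Set (c ⊔ ℓ)
  I ≐ J = (I ⊆ J) × (J ⊆ I)

  record IsIdeal (I : Subset) : Set (c ⊔ ℓ) where
    field
      resp  : ∀ {x y} → x ≈ y → I x → I y
      zero∈ : I 0#
      +∈    : ∀ {x y} → I x → I y → I (x + y)
      *∈    : ∀ r {x} → I x → I (r * x)

  Whole : Subset
  Whole _ = ⊤

  data Prod (I J : Subset) : Subset where
    gen  : ∀ {a b} → I a → J b → Prod I J (a * b)
    zro  : Prod I J 0#
    add  : ∀ {x y} → Prod I J x → Prod I J y → Prod I J (x + y)
    resp : ∀ {x y} → x ≈ y → Prod I J x → Prod I J y

  pow : Subset → ℕ → Subset
  pow M zero    = Whole
  pow M (suc i) = Prod M (pow M i)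

  prodList : List Subset → Subset
  prodList List.[]       = Whole
  prodList (I List.∷ Is) = Prod I (prodList Is)

  IsMaximal : Subset → Set (Level.suc (c ⊔ ℓ))
  IsMaximal M = IsIdeal M × ¬ M 1#
    × (∀ (J : Subset) → IsIdeal J → M ⊆ J → J 1# ⊎ J ⊆ M)

  InMR : Subset → Set (Level.suc (c ⊔ ℓ))
  InMR I = Σ (List Subset) λ Ms → Data.List.Relation.Unary.All.All IsMaximal Ms × (I ≐ prodList Ms)
    where import Data.List.Relation.Unary.All

  IsField : Set (c ⊔ ℓ)
  IsField = ¬ (1# ≈ 0#) × (∀ x → ¬ (x ≈ 0#) → ∃ λ y → x * y ≈ 1#)

  -- dim_{R/M}(M^i/M^{i+1}) = 1: a single nonzero class spanning it
  Dim1 : Subset → ℕ → Set (c ⊔ ℓ)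
  Dim1 M i = ∃ λ x → pow M i x × ¬ pow M (suc i) x
    × (∀ y → pow M i y → ∃ λ r → pow M (suc i) (y − r * x))

  DedekindType : Set (Level.suc (c ⊔ ℓ))
  DedekindType = IsField ⊎
    ((∀ M → IsMaximal M →
        (∀ i → ¬ (pow M i ≐ pow M (suc i)))
      × (∀ x → (∀ i → pow M i x) → x ≈ 0#)
      × (∀ i → Dim1 M i))
    × (∀ a → ¬ (a ≈ 0#) → Σ (List Subset) λ Ms →
         ∀ M → IsMaximal M → M a → Any (M ≐_) Ms))

  Comaximal : Subset → Subset → Set (c ⊔ ℓ)
  Comaximal I J = ∃ λ a → ∃ λ b → I a × J b × (a + b ≈ 1#)

  ∑ : ∀ {n} → (Fin n → Carrier) → Carrier
  ∑ {zero}  f = 0#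
  ∑ {suc n} f = f zero + ∑ (λ i → f (suc i))

  Unital : ∀ {n} → (Fin n → Carrier) → Set (c ⊔ ℓ)
  Unital {n} a = ∃ λ (r : Fin n → Carrier) → ∑ (λ i → r i * a i) ≈ 1#

  -- the relation defining PF_I
  ProjEq : ∀ {n} → Subset → (Fin n → Carrier) → (Fin n → Carrier) → Set (c ⊔ ℓ)
  ProjEq I a b = ∀ i j → i < j → I (a i * b j − a j * b i)

  Matrix : ℕ → Set c
  Matrix n = Fin n → Fin n → Carrier

  sign : ℕ → Carrier → Carrier
  sign zero    x = x
  sign (suc n) x = - sign n x

  det : ∀ {n} → Matrix n → Carrier
  det {zero}  A = 1#
  det {suc n} A = ∑ λ j → sign (Data.Fin.toℕ j)
                    (A zero j * det (λ r s → A (suc r) (punchIn j s)))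

  transpose : ∀ {n} → Matrix n → Matrix n
  transpose A i j = A j i

{-# OPTIONS --safe #-}
module Submission where

-- Choose, by the Chinese remainder theorem, εᵣ ≡ 1 modulo Iᵣ with εᵣ ∈ I_q for q ≠ r.
-- Since Iᵣ is a finite product of maximal ideals, every unital row vᵣ admits a
-- vector t with tᵣ = 1 and t·vᵣ a unit w⁻¹ modulo Iᵣ.  Starting from the
-- identity matrix, the rows are treated one after the other: adding εᵣ-multiples
-- of row r to the other rows and then replacing row r by a rank-one correction
-- changes nothing modulo I_q (q ≠ r), keeps the determinant equal to 1, and makes
-- row r congruent to w·vᵣ modulo Iᵣ.

open import Level using (Level; _⊔_)
open import Algebra.Bundles using (CommutativeRing)
import Algebra.Solver.Ring.AlmostCommutativeRing as ACR
open import Data.Nat as ℕ using (ℕ; zero; suc; _≤_; _<_)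
import Data.Nat.Properties as ℕP
import Data.Integer as ℤ
import Data.Integer.Properties as ℤP
open import Data.Fin using (Fin; zero; suc; toℕ; fromℕ<; punchIn)
open import Data.Fin.Properties using (_≟_; toℕ<n; toℕ-fromℕ<; toℕ-injective)
open import Data.List.Relation.Unary.All using (All; []; _∷_)
open import Data.Maybe using (Maybe; just; nothing)
open import Data.Product using (Σ; ∃; _×_; _,_; proj₁; proj₂)
open import Data.Sum using (_⊎_; inj₁; inj₂)
open import Data.Unit.Polymorphic using (tt)
open import Data.Vec.Functional using (updateAt; foldr)
open import Data.Vec.Functional.Properties
  using (updateAt-updates; updateAt-minimal; updateAt-id-local; updateAt-updateAt)
open import Function using (_∘_; const)
open import Relation.Nullary using (yes; no; contradiction)
open import Relation.Binary.Core using (Rel; _⇒_; _Preserves_⟶_; _Preserves₂_⟶_⟶_)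
open import Relation.Binary.Bundles using (Setoid)
open import Relation.Binary.Structures using (IsEquivalence)
open import Relation.Binary.PropositionalEquality as ≡ using (_≡_; _≢_)
import Relation.Binary.Reasoning.Setoid as SetoidReasoning
open import Defs renaming (gen to ·-gen; zro to ·-zero; add to ·-add; resp to ·-resp)

-- The ring solver needs coefficients with decidable equality, so ℤ is mapped into R.
-- With the tail-call optimised multiple, ⟦ + 0 ⟧ℤ and ⟦ + 1 ⟧ℤ reduce to 0# and 1#,
-- so the constants :0 and :1 of solved identities match 0# and 1# in goals.
module IntegerCoefficients {c ℓ : Level} (R : CommutativeRing c ℓ) where
  open ℤ using (ℤ; +_; -[1+_])
  open CommutativeRing R
  open import Algebra.Properties.Ring ring using (-‿involutive; -0#≈0#; -‿distribˡ-*; -‿distribʳ-*; -‿+-comm)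
  open import Algebra.Properties.Semiring.Mult.TCOptimised semiring
    using (1+×; ×-homo-+; ×1-homo-*) renaming (_×_ to _·_)
  open SetoidReasoning setoid

  ⟦_⟧ℤ : ℤ → Carrier
  ⟦ + n      ⟧ℤ = n · 1#
  ⟦ -[1+ n ] ⟧ℤ = - (suc n · 1#)

  -‿homo : ∀ i → ⟦ ℤ.- i ⟧ℤ ≈ - ⟦ i ⟧ℤ
  -‿homo (+ zero)  = sym -0#≈0#
  -‿homo (+ suc n) = refl
  -‿homo -[1+ n ]  = sym (-‿involutive _)

  ⊖-homo : ∀ m n → ⟦ m ℤ.⊖ n ⟧ℤ ≈ m · 1# - n · 1#
  ⊖-homo zero    zero    = sym (-‿inverseʳ 0#)
  ⊖-homo zero    (suc n) = sym (+-identityˡ _)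
  ⊖-homo (suc m) zero    = sym (trans (+-congˡ -0#≈0#) (+-identityʳ _))
  ⊖-homo (suc m) (suc n) = begin
    ⟦ suc m ℤ.⊖ suc n ⟧ℤ            ≡⟨ ≡.cong ⟦_⟧ℤ (ℤP.[1+m]⊖[1+n]≡m⊖n m n) ⟩
    ⟦ m ℤ.⊖ n ⟧ℤ                    ≈⟨ ⊖-homo m n ⟩
    m · 1# - n · 1#                 ≈⟨ shift (m · 1#) (n · 1#) ⟩
    (1# + m · 1#) - (1# + n · 1#)   ≈⟨ +-cong (1+× m 1#) (-‿cong (1+× n 1#)) ⟨
    suc m · 1# - suc n · 1#         ∎
    where
    shift : ∀ a b → a - b ≈ (1# + a) - (1# + b)
    shift a b = begin
      a - b                     ≈⟨ +-identityˡ _ ⟨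
      0# + (a - b)              ≈⟨ +-congʳ (-‿inverseʳ 1#) ⟨
      (1# - 1#) + (a - b)       ≈⟨ +-assoc 1# (- 1#) (a - b) ⟩
      1# + (- 1# + (a - b))     ≈⟨ +-congˡ (+-assoc (- 1#) a (- b)) ⟨
      1# + ((- 1# + a) - b)     ≈⟨ +-congˡ (+-congʳ (+-comm (- 1#) a)) ⟩
      1# + ((a - 1#) - b)       ≈⟨ +-congˡ (+-assoc a (- 1#) (- b)) ⟩
      1# + (a + (- 1# - b))     ≈⟨ +-assoc 1# a (- 1# - b) ⟨
      (1# + a) + (- 1# - b)     ≈⟨ +-congˡ (-‿+-comm 1# b) ⟩
      (1# + a) - (1# + b)       ∎

  +-homo : ∀ i j → ⟦ i ℤ.+ j ⟧ℤ ≈ ⟦ i ⟧ℤ + ⟦ j ⟧ℤ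
  +-homo (+ m)    (+ n)    = ×-homo-+ 1# m n
  +-homo (+ m)    -[1+ n ] = ⊖-homo m (suc n)
  +-homo -[1+ m ] (+ n)    = trans (⊖-homo n (suc m)) (+-comm _ _)
  +-homo -[1+ m ] -[1+ n ] = begin
    - (suc (suc (m ℕ.+ n)) · 1#)      ≡⟨ ≡.cong (λ k → - (suc k · 1#)) (ℕP.+-suc m n) ⟨
    - ((suc m ℕ.+ suc n) · 1#)        ≈⟨ -‿cong (×-homo-+ 1# (suc m) (suc n)) ⟩
    - (suc m · 1# + suc n · 1#)       ≈⟨ -‿+-comm _ _ ⟨
    - (suc m · 1#) + - (suc n · 1#)   ∎

  *-homo-pos : ∀ m j → ⟦ + m ℤ.* j ⟧ℤ ≈ m · 1# * ⟦ j ⟧ℤ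
  *-homo-pos m (+ n)    = trans (reflexive (≡.cong ⟦_⟧ℤ (≡.sym (ℤP.pos-* m n)))) (×1-homo-* m n)
  *-homo-pos m -[1+ n ] = begin
    ⟦ + m ℤ.* -[1+ n ] ⟧ℤ        ≡⟨ ≡.cong ⟦_⟧ℤ (ℤP.neg-distribʳ-* (+ m) (+ suc n)) ⟨
    ⟦ ℤ.- (+ m ℤ.* + suc n) ⟧ℤ   ≈⟨ -‿homo (+ m ℤ.* + suc n) ⟩
    - ⟦ + m ℤ.* + suc n ⟧ℤ       ≈⟨ -‿cong (*-homo-pos m (+ suc n)) ⟩
    - (m · 1# * (suc n · 1#))    ≈⟨ -‿distribʳ-* _ _ ⟩
    m · 1# * - (suc n · 1#)      ∎

  *-homo : ∀ i j → ⟦ i ℤ.* j ⟧ℤ ≈ ⟦ i ⟧ℤ * ⟦ j ⟧ℤ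
  *-homo (+ m)    j = *-homo-pos m j
  *-homo -[1+ m ] j = begin
    ⟦ -[1+ m ] ℤ.* j ⟧ℤ        ≡⟨ ≡.cong ⟦_⟧ℤ (ℤP.neg-distribˡ-* (+ suc m) j) ⟨
    ⟦ ℤ.- (+ suc m ℤ.* j) ⟧ℤ   ≈⟨ -‿homo (+ suc m ℤ.* j) ⟩
    - ⟦ + suc m ℤ.* j ⟧ℤ       ≈⟨ -‿cong (*-homo-pos (suc m) j) ⟩
    - (suc m · 1# * ⟦ j ⟧ℤ)    ≈⟨ -‿distribˡ-* _ _ ⟩
    - (suc m · 1#) * ⟦ j ⟧ℤ    ∎

  embedding : ℤ.+-*-rawRing ACR.-Raw-AlmostCommutative⟶ ACR.fromCommutativeRing R
  embedding = record
    { ⟦_⟧ = ⟦_⟧ℤ ; +-homo = +-homo ; *-homo = *-homo ; -‿homo = -‿homo ; 0-homo = refl ; 1-homo = refl }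

  ≟-weak : ∀ i j → Maybe (⟦ i ⟧ℤ ≈ ⟦ j ⟧ℤ)
  ≟-weak i j with i ℤ.≟ j
  ... | yes ≡.refl = just refl
  ... | no _       = nothing

  open import Algebra.Solver.Ring ℤ.+-*-rawRing (ACR.fromCommutativeRing R) embedding ≟-weak public

  :0 :1 : ∀ {n} → Polynomial n
  :0 = con (+ 0)
  :1 = con (+ 1)

module Congruences {c ℓ : Level} (R : CommutativeRing c ℓ) where
  open CommutativeRing R hiding (zero)
  open IntegerCoefficients R using (solve; _:=_; _:+_; _:*_; :-_; _:-_; :0)
  open import Algebra.Properties.Ring ring using (-1*x≈-x)

  record Congruence ℓ′ : Set (c ⊔ ℓ ⊔ Level.suc ℓ′) where
    infix 4 _∼_
    field
      _∼_             : Rel Carrier ℓ′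
      ∼-isEquivalence : IsEquivalence _∼_
      ≈⇒∼             : _≈_ ⇒ _∼_
      +-resp          : _+_ Preserves₂ _∼_ ⟶ _∼_ ⟶ _∼_
      *-resp          : _*_ Preserves₂ _∼_ ⟶ _∼_ ⟶ _∼_
      -‿resp          : -_ Preserves _∼_ ⟶ _∼_

    ∼-setoid : Setoid c ℓ′
    ∼-setoid = record { isEquivalence = ∼-isEquivalence }

    open IsEquivalence ∼-isEquivalence public
      using () renaming (refl to ∼-refl; trans to ∼-trans)

  ≈-congruence : Congruence ℓ
  ≈-congruence = record
    { ∼-isEquivalence = isEquivalence ; ≈⇒∼ = λ x≈y → x≈y
    ; +-resp = +-cong ; *-resp = *-cong ; -‿resp = -‿cong }

  infix 4 _∼_mod_
  _∼_mod_ : Carrier → Carrier → Subset R → Set (c ⊔ ℓ)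
  x ∼ y mod I = I (x - y)

  module Ideal {I : Subset R} (isIdeal : IsIdeal R I) where
    open IsIdeal isIdeal public

    -‿∈ : ∀ {x} → I x → I (- x)
    -‿∈ {x} x∈I = resp (-1*x≈-x x) (*∈ (- 1#) x∈I)

    -∈ : ∀ {x y} → I x → I y → I (x - y)
    -∈ x∈I y∈I = +∈ x∈I (-‿∈ y∈I)

    *∈ʳ : ∀ r {x} → I x → I (x * r)
    *∈ʳ r x∈I = resp (*-comm r _) (*∈ r x∈I)

    congruence : Congruence (c ⊔ ℓ)
    congruence = record
      { ∼-isEquivalence = record
        { refl  = λ {x} → ≈⇒∼ (refl {x})
        ; sym   = λ {x} {y} x∼y → resp (solve 2 (λ x y → :- (x :- y) := y :- x) refl x y) (-‿∈ x∼y)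
        ; trans = λ {x} {y} {z} x∼y y∼z →
            resp (solve 3 (λ x y z → (x :- y) :+ (y :- z) := x :- z) refl x y z) (+∈ x∼y y∼z) }
      ; ≈⇒∼    = ≈⇒∼
      ; +-resp = λ {x} {x′} {y} {y′} x∼x′ y∼y′ →
          resp (solve 4 (λ x x′ y y′ → (x :- x′) :+ (y :- y′) := (x :+ y) :- (x′ :+ y′)) refl x x′ y y′)
               (+∈ x∼x′ y∼y′)
      ; *-resp = λ {x} {x′} {y} {y′} x∼x′ y∼y′ →
          resp (solve 4 (λ x x′ y y′ → (x :- x′) :* y :+ x′ :* (y :- y′) := x :* y :- x′ :* y′) refl x x′ y y′)
               (+∈ (*∈ʳ y x∼x′) (*∈ x′ y∼y′))
      ; -‿resp = λ {x} {y} x∼y →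
          resp (solve 2 (λ x y → :- (x :- y) := (:- x) :- (:- y)) refl x y) (-‿∈ x∼y)
      }
      where
      ≈⇒∼ : ∀ {x y} → x ≈ y → x ∼ y mod I
      ≈⇒∼ {x} {y} x≈y = resp (sym (trans (+-congʳ x≈y) (-‿inverseʳ y))) zero∈

    open Congruence congruence public

    ∼0⇒∈ : ∀ {x} → x ∼ 0# mod I → I x
    ∼0⇒∈ {x} = resp (solve 1 (λ x → x :- :0 := x) refl x)

module Sums {c ℓ : Level} (R : CommutativeRing c ℓ) where
  open CommutativeRing R hiding (zero)
  open Congruences R
  open IntegerCoefficients R using (solve; _:=_; _:+_; _:*_)
  open import Algebra.Properties.Ring ring using (-1*x≈-x)
  open SetoidReasoning setoid

  open import Algebra.Properties.Semiring.Sum semiring public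
    using (sum; ∑-distrib-+; ∑-comm; *-distribˡ-sum; *-distribʳ-sum; sum-cong-≋; sum-cong-≗; sum-replicate-zero)

  ∑≡sum : ∀ {n} (f : Fin n → Carrier) → ∑ R f ≡ sum f
  ∑≡sum {zero}  f = ≡.refl
  ∑≡sum {suc n} f = ≡.cong (f zero +_) (∑≡sum (f ∘ suc))

  module _ {ℓ′} (C : Congruence ℓ′) where
    open Congruence C

    sum-resp : ∀ {n} {f g : Fin n → Carrier} → (∀ i → f i ∼ g i) → sum f ∼ sum g
    sum-resp {zero}  f∼g = ∼-refl
    sum-resp {suc n} f∼g = +-resp (f∼g zero) (sum-resp (f∼g ∘ suc))

  sum-zero : ∀ {n} {f : Fin n → Carrier} → (∀ i → f i ≈ 0#) → sum f ≈ 0#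
  sum-zero {n} f≈0 = trans (sum-cong-≋ f≈0) (sum-replicate-zero n)

  sum-neg : ∀ {n} (f : Fin n → Carrier) → sum (λ i → - f i) ≈ - sum f
  sum-neg f = begin
    sum (λ i → - f i)         ≈⟨ sum-cong-≋ (λ i → -1*x≈-x (f i)) ⟨
    sum (λ i → - 1# * f i)    ≈⟨ *-distribˡ-sum (- 1#) f ⟨
    - 1# * sum f              ≈⟨ -1*x≈-x _ ⟩
    - sum f                   ∎

  δ : ∀ {n} → Fin n → Fin n → Carrier
  δ zero    zero    = 1#
  δ zero    (suc j) = 0#
  δ (suc i) zero    = 0#
  δ (suc i) (suc j) = δ i j

  δ-diag : ∀ {n} (i : Fin n) → δ i i ≈ 1#
  δ-diag zero    = refl
  δ-diag (suc i) = δ-diag i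

  δ-sym : ∀ {n} (i j : Fin n) → δ i j ≡ δ j i
  δ-sym zero    zero    = ≡.refl
  δ-sym zero    (suc j) = ≡.refl
  δ-sym (suc i) zero    = ≡.refl
  δ-sym (suc i) (suc j) = δ-sym i j

  sum-δˡ : ∀ {n} (i : Fin n) (x : Fin n → Carrier) → sum (λ j → δ i j * x j) ≈ x i
  sum-δˡ zero x = begin
    1# * x zero + sum (λ j → 0# * x (suc j))   ≈⟨ +-cong (*-identityˡ _) (sum-zero (λ j → zeroˡ (x (suc j)))) ⟩
    x zero + 0#                                ≈⟨ +-identityʳ _ ⟩
    x zero                                     ∎
  sum-δˡ (suc i) x = trans (+-cong (zeroˡ _) (sum-δˡ i (x ∘ suc))) (+-identityˡ _)

  sum-δʳ : ∀ {n} (x : Fin n → Carrier) (j : Fin n) → sum (λ i → x i * δ i j) ≈ x j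
  sum-δʳ x j = trans (sum-cong-≋ (λ i → trans (*-comm (x i) _) (*-congʳ (reflexive (δ-sym i j))))) (sum-δˡ j x)

  dot : ∀ {n} → (Fin n → Carrier) → (Fin n → Carrier) → Carrier
  dot t v = sum (λ i → t i * v i)

  dot-linear : ∀ {n} a b (x y v : Fin n → Carrier) →
               dot (λ i → a * x i + b * y i) v ≈ a * dot x v + b * dot y v
  dot-linear a b x y v = begin
    sum (λ i → (a * x i + b * y i) * v i)
      ≈⟨ sum-cong-≋ (λ i → solve 5 (λ a b x y v → (a :* x :+ b :* y) :* v := a :* (x :* v) :+ b :* (y :* v))
                                    refl a b (x i) (y i) (v i)) ⟩
    sum (λ i → a * (x i * v i) + b * (y i * v i))
      ≈⟨ ∑-distrib-+ (λ i → a * (x i * v i)) (λ i → b * (y i * v i)) ⟩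
    sum (λ i → a * (x i * v i)) + sum (λ i → b * (y i * v i))
      ≈⟨ +-cong (*-distribˡ-sum a (λ i → x i * v i)) (*-distribˡ-sum b (λ i → y i * v i)) ⟨
    a * dot x v + b * dot y v
      ∎

infixl 9 _[_]≔_
_[_]≔_ : ∀ {a} {A : Set a} {n} → (Fin n → A) → Fin n → A → Fin n → A
xs [ i ]≔ x = updateAt xs i (const x)

module Determinants {c ℓ : Level} (R : CommutativeRing c ℓ) where
  open CommutativeRing R hiding (zero)
  open Congruences R
  open Sums R
  open IntegerCoefficients R using (solve; _:=_; _:+_; _:*_; :-_; _:-_; :1)
  open import Algebra.Properties.Ring ring using (-‿involutive; -0#≈0#; -‿distribˡ-*)
  open SetoidReasoning setoid

  private variable
    n : ℕ

  []≔-same : ∀ {a} {A : Set a} (xs : Fin n → A) i x → (xs [ i ]≔ x) i ≡ x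
  []≔-same xs i x = updateAt-updates i xs

  []≔-other : ∀ {a} {A : Set a} (xs : Fin n → A) {i j} x → j ≢ i → (xs [ i ]≔ x) j ≡ xs j
  []≔-other xs {i} {j} x j≢i = updateAt-minimal j i xs j≢i

  []≔-self : ∀ {a} {A : Set a} (xs : Fin n → A) i j → (xs [ i ]≔ xs i) j ≡ xs j
  []≔-self xs i = updateAt-id-local i xs ≡.refl

  []≔-restrict : ∀ {m k} (F : Fin m → Fin n → Carrier) q x (g : Fin k → Fin n) r s →
                 (F [ q ]≔ x) r (g s) ≡ ((λ r s → F r (g s)) [ q ]≔ (x ∘ g)) r s
  []≔-restrict F zero    x g zero    s = ≡.refl
  []≔-restrict F zero    x g (suc r) s = ≡.refl
  []≔-restrict F (suc q) x g zero    s = ≡.refl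
  []≔-restrict F (suc q) x g (suc r) s = []≔-restrict (F ∘ suc) q x g r s

  signedSum : (Fin n → Carrier) → Carrier
  signedSum f = sum (λ j → sign R (toℕ j) (f j))

  minor : Matrix R (suc n) → Fin (suc n) → Matrix R n
  minor A j r s = A (suc r) (punchIn j s)

  det-expand : (A : Matrix R (suc n)) → det R A ≡ signedSum (λ j → A zero j * det R (minor A j))
  det-expand A = ∑≡sum (λ j → sign R (toℕ j) (A zero j * det R (minor A j)))

  module _ {ℓ′} (C : Congruence ℓ′) where
    open Congruence C

    []≔-resp : ∀ (A B : Matrix R n) q {x y : Fin n → Carrier} →
               (∀ j → x j ∼ y j) → (∀ i → i ≢ q → ∀ j → A i j ∼ B i j) →
               ∀ i j → (A [ q ]≔ x) i j ∼ (B [ q ]≔ y) i j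
    []≔-resp A B q {x} {y} x∼y A∼B i j with i ≟ q
    ... | yes ≡.refl = ≡.subst₂ _∼_ (≡.cong-app (≡.sym ([]≔-same A q x)) j)
                                    (≡.cong-app (≡.sym ([]≔-same B q y)) j) (x∼y j)
    ... | no i≢q     = ≡.subst₂ _∼_ (≡.cong-app (≡.sym ([]≔-other A x i≢q)) j)
                                    (≡.cong-app (≡.sym ([]≔-other B y i≢q)) j) (A∼B i i≢q j)

    sign-resp : ∀ k {x y} → x ∼ y → sign R k x ∼ sign R k y
    sign-resp zero    x∼y = x∼y
    sign-resp (suc k) x∼y = -‿resp (sign-resp k x∼y)

    signedSum-resp : {f g : Fin n → Carrier} → (∀ j → f j ∼ g j) → signedSum f ∼ signedSum g
    signedSum-resp f∼g = sum-resp C (λ j → sign-resp (toℕ j) (f∼g j))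

    det-resp : ∀ {n} {A B : Matrix R n} → (∀ i j → A i j ∼ B i j) → det R A ∼ det R B
    det-resp {zero}          A∼B = ∼-refl
    det-resp {suc n} {A} {B} A∼B = ≡.subst₂ _∼_ (≡.sym (det-expand A)) (≡.sym (det-expand B))
      (signedSum-resp (λ j → *-resp (A∼B zero j) (det-resp (λ r s → A∼B (suc r) (punchIn j s)))))

  det-cong : {A B : Matrix R n} → (∀ i j → A i j ≈ B i j) → det R A ≈ det R B
  det-cong = det-resp ≈-congruence

  sign-* : ∀ k x → sign R k x ≈ sign R k 1# * x
  sign-* zero    x = sym (*-identityˡ x)
  sign-* (suc k) x = trans (-‿cong (sign-* k x)) (-‿distribˡ-* _ x)

  sign-zero : ∀ k → sign R k 0# ≈ 0#
  sign-zero k = trans (sign-* k 0#) (zeroʳ _)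

  sign-linear : ∀ k a b x y → sign R k (a * x + b * y) ≈ a * sign R k x + b * sign R k y
  sign-linear k a b x y = begin
    sign R k (a * x + b * y)
      ≈⟨ sign-* k _ ⟩
    sign R k 1# * (a * x + b * y)
      ≈⟨ solve 5 (λ s a b x y → s :* (a :* x :+ b :* y) := a :* (s :* x) :+ b :* (s :* y))
        refl (sign R k 1#) a b x y ⟩
    a * (sign R k 1# * x) + b * (sign R k 1# * y)
      ≈⟨ +-cong (*-congˡ (sign-* k x)) (*-congˡ (sign-* k y)) ⟨
    a * sign R k x + b * sign R k y           ∎

  signedSum-linear : ∀ a b (f g : Fin n → Carrier) →
                     signedSum (λ j → a * f j + b * g j) ≈ a * signedSum f + b * signedSum g
  signedSum-linear a b f g = begin
    sum (λ j → sign R (toℕ j) (a * f j + b * g j))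
      ≈⟨ sum-cong-≋ (λ j → sign-linear (toℕ j) a b (f j) (g j)) ⟩
    sum (λ j → a * sign R (toℕ j) (f j) + b * sign R (toℕ j) (g j))
      ≈⟨ ∑-distrib-+ (λ j → a * sign R (toℕ j) (f j)) (λ j → b * sign R (toℕ j) (g j)) ⟩
    sum (λ j → a * sign R (toℕ j) (f j)) + sum (λ j → b * sign R (toℕ j) (g j))
      ≈⟨ +-cong (*-distribˡ-sum a (λ j → sign R (toℕ j) (f j))) (*-distribˡ-sum b (λ j → sign R (toℕ j) (g j))) ⟨
    a * signedSum f + b * signedSum g ∎

  det-[]≔-suc : ∀ (A : Matrix R (suc n)) q x →
                det R (A [ suc q ]≔ x) ≈ signedSum (λ j → A zero j * det R (minor A j [ q ]≔ (x ∘ punchIn j)))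
  det-[]≔-suc A q x = trans (reflexive (det-expand (A [ suc q ]≔ x)))
    (signedSum-resp ≈-congruence (λ j → *-congˡ {A zero j} (det-cong (λ r s →
      reflexive ([]≔-restrict (A ∘ suc) q x (punchIn j) r s)))))

  det-linear : ∀ (A : Matrix R n) q a b (x y : Fin n → Carrier) →
               det R (A [ q ]≔ (λ j → a * x j + b * y j)) ≈ a * det R (A [ q ]≔ x) + b * det R (A [ q ]≔ y)
  det-linear A zero a b x y = begin
    det R (A [ zero ]≔ (λ j → a * x j + b * y j))
      ≡⟨ det-expand (A [ zero ]≔ (λ j → a * x j + b * y j)) ⟩
    signedSum (λ j → (a * x j + b * y j) * d j)
      ≈⟨ signedSum-resp ≈-congruence (λ j → solve 5 (λ a b x y d → (a :* x :+ b :* y) :* d := a :* (x :* d) :+ b :* (y :* d))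
        refl a b (x j) (y j) (d j)) ⟩
    signedSum (λ j → a * (x j * d j) + b * (y j * d j))
      ≈⟨ signedSum-linear a b (λ j → x j * d j) (λ j → y j * d j) ⟩
    a * signedSum (λ j → x j * d j) + b * signedSum (λ j → y j * d j)
      ≡⟨ ≡.cong₂ (λ u v → a * u + b * v) (det-expand (A [ zero ]≔ x)) (det-expand (A [ zero ]≔ y)) ⟨
    a * det R (A [ zero ]≔ x) + b * det R (A [ zero ]≔ y) ∎
    where
    d = λ j → det R (minor A j)
  det-linear A (suc q) a b x y = begin
    det R (A [ suc q ]≔ (λ j → a * x j + b * y j))
      ≈⟨ det-[]≔-suc A q (λ j → a * x j + b * y j) ⟩
    signedSum (λ j → A zero j * det R (minor A j [ q ]≔ (λ s → a * x (punchIn j s) + b * y (punchIn j s))))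
      ≈⟨ signedSum-resp ≈-congruence (λ j →
        *-congˡ {A zero j} (det-linear (minor A j) q a b (x ∘ punchIn j) (y ∘ punchIn j))) ⟩
    signedSum (λ j → A zero j * (a * dx j + b * dy j))
      ≈⟨ signedSum-resp ≈-congruence (λ j → solve 5 (λ e a b u v → e :* (a :* u :+ b :* v) := a :* (e :* u) :+ b :* (e :* v))
        refl (A zero j) a b (dx j) (dy j)) ⟩
    signedSum (λ j → a * (A zero j * dx j) + b * (A zero j * dy j))
      ≈⟨ signedSum-linear a b (λ j → A zero j * dx j) (λ j → A zero j * dy j) ⟩
    a * signedSum (λ j → A zero j * dx j) + b * signedSum (λ j → A zero j * dy j)
      ≈⟨ +-cong (*-congˡ (det-[]≔-suc A q x)) (*-congˡ (det-[]≔-suc A q y)) ⟨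
    a * det R (A [ suc q ]≔ x) + b * det R (A [ suc q ]≔ y) ∎
    where
    dx = λ j → det R (minor A j [ q ]≔ (x ∘ punchIn j))
    dy = λ j → det R (minor A j [ q ]≔ (y ∘ punchIn j))

  det-[]≔-cong : ∀ (A : Matrix R n) q {x y : Fin n → Carrier} → (∀ j → x j ≈ y j) →
                 det R (A [ q ]≔ x) ≈ det R (A [ q ]≔ y)
  det-[]≔-cong A q x≈y = det-cong ([]≔-resp ≈-congruence A A q x≈y (λ _ _ _ → refl))

  det-[]≔-+ : ∀ (A : Matrix R n) q (x y : Fin n → Carrier) →
              det R (A [ q ]≔ (λ j → x j + y j)) ≈ det R (A [ q ]≔ x) + det R (A [ q ]≔ y)
  det-[]≔-+ A q x y = begin
    det R (A [ q ]≔ (λ j → x j + y j))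
      ≈⟨ det-[]≔-cong A q (λ j → +-cong (*-identityˡ (x j)) (*-identityˡ (y j))) ⟨
    det R (A [ q ]≔ (λ j → 1# * x j + 1# * y j))
      ≈⟨ det-linear A q 1# 1# x y ⟩
    1# * det R (A [ q ]≔ x) + 1# * det R (A [ q ]≔ y)
      ≈⟨ +-cong (*-identityˡ _) (*-identityˡ _) ⟩
    det R (A [ q ]≔ x) + det R (A [ q ]≔ y)             ∎

  det-[]≔-* : ∀ (A : Matrix R n) q a (x : Fin n → Carrier) →
              det R (A [ q ]≔ (λ j → a * x j)) ≈ a * det R (A [ q ]≔ x)
  det-[]≔-* A q a x = begin
    det R (A [ q ]≔ (λ j → a * x j))
      ≈⟨ det-[]≔-cong A q (λ j → trans (+-congˡ (zeroˡ (x j))) (+-identityʳ _)) ⟨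
    det R (A [ q ]≔ (λ j → a * x j + 0# * x j))
      ≈⟨ det-linear A q a 0# x x ⟩
    a * det R (A [ q ]≔ x) + 0# * det R (A [ q ]≔ x)
      ≈⟨ trans (+-congˡ (zeroˡ _)) (+-identityʳ _) ⟩
    a * det R (A [ q ]≔ x)                              ∎

  det-[]≔-self : ∀ (A : Matrix R n) q → det R (A [ q ]≔ A q) ≈ det R A
  det-[]≔-self A q = det-cong (λ i → reflexive ∘ ≡.cong-app ([]≔-self A q i))

  det-[]≔-sum : ∀ {m} (A : Matrix R n) q (k : Fin m → Carrier) (Y : Fin m → Fin n → Carrier) →
                det R (A [ q ]≔ (λ j → sum (λ s → k s * Y s j))) ≈ sum (λ s → k s * det R (A [ q ]≔ Y s))
  det-[]≔-sum {m = zero} A q k Y = begin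
    det R (A [ q ]≔ (λ _ → 0#))         ≈⟨ det-[]≔-cong A q (λ _ → zeroˡ 0#) ⟨
    det R (A [ q ]≔ (λ _ → 0# * 0#))    ≈⟨ det-[]≔-* A q 0# (λ _ → 0#) ⟩
    0# * det R (A [ q ]≔ (λ _ → 0#))    ≈⟨ zeroˡ _ ⟩
    0#                                  ∎
  det-[]≔-sum {m = suc m} A q k Y = begin
    det R (A [ q ]≔ (λ j → k zero * Y zero j + rest j))
      ≈⟨ det-[]≔-cong A q (λ j → +-congˡ (*-identityˡ (rest j))) ⟨
    det R (A [ q ]≔ (λ j → k zero * Y zero j + 1# * rest j))
      ≈⟨ det-linear A q (k zero) 1# (Y zero) rest ⟩
    k zero * det R (A [ q ]≔ Y zero) + 1# * det R (A [ q ]≔ rest)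
      ≈⟨ +-congˡ (trans (*-identityˡ _) (det-[]≔-sum A q (k ∘ suc) (Y ∘ suc))) ⟩
    k zero * det R (A [ q ]≔ Y zero) + sum (λ s → k (suc s) * det R (A [ q ]≔ Y (suc s))) ∎
    where
    rest = λ j → sum (λ s → k (suc s) * Y (suc s) j)

  det-δ : ∀ {n} → det R (δ {n}) ≈ 1#
  det-δ {zero}  = refl
  det-δ {suc n} = begin
    det R (δ {suc n})
      ≡⟨ det-expand (δ {suc n}) ⟩
    1# * det R (δ {n}) + sum rest
      ≈⟨ +-cong (*-identityˡ _) (sum-zero {f = rest} (λ j → trans (sign-resp ≈-congruence (suc (toℕ j)) (zeroˡ _))
                                                                   (sign-zero (suc (toℕ j))))) ⟩
    det R (δ {n}) + 0#
      ≈⟨ trans (+-identityʳ _) (det-δ {n}) ⟩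
    1# ∎
    where
    rest = λ j → sign R (toℕ (suc j)) (0# * det R (minor (δ {suc n}) (suc j)))

  signedSum-swap : ∀ {m k} (a : Fin m → Carrier) (b : Fin k → Carrier) (D : Fin k → Fin m → Carrier) →
                   sum (λ j → sign R (suc (toℕ j)) (a j * signedSum (λ i → b i * D i j))) ≈
                   sum (λ i → sign R (suc (toℕ i)) (b i * signedSum (λ j → a j * D i j)))
  signedSum-swap a b D = begin
    sum (λ j → sign R (suc (toℕ j)) (a j * signedSum (λ i → b i * D i j)))
      ≈⟨ sum-cong-≋ (λ j → spread (toℕ j) (a j) b (λ i → D i j)) ⟩
    sum (λ j → sum (λ i → - (σ j * σ i * a j * b i * D i j)))
      ≈⟨ ∑-comm (λ j i → - (σ j * σ i * a j * b i * D i j)) ⟩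
    sum (λ i → sum (λ j → - (σ j * σ i * a j * b i * D i j)))
      ≈⟨ sum-cong-≋ (λ i → sum-cong-≋ (λ j → solve 5 (λ x y z w v → :- (x :* y :* z :* w :* v) := :- (y :* x :* w :* z :* v))
        refl (σ j) (σ i) (a j) (b i) (D i j))) ⟩
    sum (λ i → sum (λ j → - (σ i * σ j * b i * a j * D i j)))
      ≈⟨ sum-cong-≋ (λ i → spread (toℕ i) (b i) a (D i)) ⟨
    sum (λ i → sign R (suc (toℕ i)) (b i * signedSum (λ j → a j * D i j))) ∎
    where
    σ : ∀ {p} → Fin p → Carrier
    σ i = sign R (toℕ i) 1#
    spread : ∀ {p} t x (y E : Fin p → Carrier) →
             sign R (suc t) (x * signedSum (λ i → y i * E i)) ≈ sum (λ i → - (sign R t 1# * σ i * x * y i * E i))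
    spread t x y E = begin
      - sign R t (x * signedSum (λ i → y i * E i))
        ≈⟨ -‿cong (trans (sign-* t _) (*-congˡ (*-congˡ (sum-cong-≋ (λ i → sign-* (toℕ i) (y i * E i)))))) ⟩
      - (sign R t 1# * (x * sum (λ i → σ i * (y i * E i))))
        ≈⟨ solve 3 (λ s x S → :- (s :* (x :* S)) := (:- (s :* x)) :* S) refl (sign R t 1#) x _ ⟩
      - (sign R t 1# * x) * sum (λ i → σ i * (y i * E i))
        ≈⟨ *-distribˡ-sum (- (sign R t 1# * x)) (λ i → σ i * (y i * E i)) ⟩
      sum (λ i → - (sign R t 1# * x) * (σ i * (y i * E i)))
        ≈⟨ sum-cong-≋ (λ i → solve 5 (λ s x σ y e → (:- (s :* x)) :* (σ :* (y :* e)) := :- (s :* σ :* x :* y :* e))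
                                      refl (sign R t 1#) x (σ i) (y i) (E i)) ⟩
      sum (λ i → - (sign R t 1# * σ i * x * y i * E i)) ∎

  det-expand-column : ∀ {n} (A : Matrix R (suc n)) →
                      det R A ≈ signedSum (λ i → A i zero * det R (λ r s → A (punchIn i r) (suc s)))
  det-expand-column {zero}  A = refl
  det-expand-column {suc n} A = begin
    det R A
      ≡⟨ det-expand A ⟩
    t₀ + sum (λ j → sign R (suc (toℕ j)) (a j * det R (minor A (suc j))))
      ≈⟨ +-congˡ (sum-cong-≋ (λ j → sign-resp ≈-congruence (suc (toℕ j))
                                       (*-congˡ {a j} (det-expand-column (minor A (suc j)))))) ⟩
    t₀ + sum (λ j → sign R (suc (toℕ j)) (a j * signedSum (λ i → b i * det R (D i j))))
      ≈⟨ +-congˡ (signedSum-swap a b (λ i j → det R (D i j))) ⟩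
    t₀ + sum (λ i → sign R (suc (toℕ i)) (b i * signedSum (λ j → a j * det R (D i j))))
      ≡⟨ ≡.cong (t₀ +_) (sum-cong-≗ (λ i → ≡.cong (λ d → sign R (suc (toℕ i)) (b i * d))
                                                  (det-expand (λ r s → A (punchIn (suc i) r) (suc s))))) ⟨
    signedSum (λ i → A i zero * det R (λ r s → A (punchIn i r) (suc s))) ∎
    where
    t₀ = A zero zero * det R (minor A zero)
    a b : Fin (suc n) → Carrier
    a j = A zero (suc j)
    b i = A (suc i) zero
    D : Fin (suc n) → Fin (suc n) → Matrix R n
    D i j r s = A (suc (punchIn i r)) (suc (punchIn j s))

  det-transpose : ∀ {n} (A : Matrix R n) → det R (transpose R A) ≈ det R A
  det-transpose {zero}  A = refl
  det-transpose {suc n} A = begin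
    det R (transpose R A)
      ≡⟨ det-expand (transpose R A) ⟩
    signedSum (λ j → A j zero * det R (minor (transpose R A) j))
      ≈⟨ signedSum-resp ≈-congruence (λ j → *-congˡ {A j zero} (det-transpose (λ r s → A (punchIn j r) (suc s)))) ⟩
    signedSum (λ j → A j zero * det R (λ r s → A (punchIn j r) (suc s)))
      ≈⟨ det-expand-column A ⟨
    det R A ∎

  -- Expanding along row 0, the terms of columns 0 and 1 cancel and every other minor
  -- again has equal columns 0 and 1.
  det-equalColumns01 : ∀ {n} (A : Matrix R (suc (suc n))) → (∀ i → A i zero ≈ A i (suc zero)) → det R A ≈ 0#
  det-equalColumns01-rest : ∀ n (A : Matrix R (suc (suc n))) → (∀ i → A i zero ≈ A i (suc zero)) → ∀ j →
                            sign R (toℕ (suc (suc j))) (A zero (suc (suc j)) * det R (minor A (suc (suc j)))) ≈ 0#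

  det-equalColumns01 {n} A eq = begin
    det R A
      ≡⟨ det-expand A ⟩
    t₀ + (- t₁ + sum rest)
      ≈⟨ +-assoc t₀ (- t₁) (sum rest) ⟨
    (t₀ - t₁) + sum rest
      ≈⟨ +-cong (trans (+-congʳ t₀≈t₁) (-‿inverseʳ t₁)) (sum-zero (det-equalColumns01-rest n A eq)) ⟩
    0# + 0#
      ≈⟨ +-identityʳ 0# ⟩
    0#                        ∎
    where
    t₀ = A zero zero * det R (minor A zero)
    t₁ = A zero (suc zero) * det R (minor A (suc zero))
    rest = λ j → sign R (toℕ (suc (suc j))) (A zero (suc (suc j)) * det R (minor A (suc (suc j))))
    minors : ∀ r s → minor A zero r s ≈ minor A (suc zero) r s
    minors r zero    = sym (eq (suc r))
    minors r (suc s) = refl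
    t₀≈t₁ : t₀ ≈ t₁
    t₀≈t₁ = *-cong (eq zero) (det-cong minors)
  det-equalColumns01-rest (suc n) A eq j = trans
    (sign-resp ≈-congruence (toℕ (suc (suc j)))
      (trans (*-congˡ (det-equalColumns01 (minor A (suc (suc j))) (λ r → eq (suc r)))) (zeroʳ _)))
    (sign-zero (toℕ (suc (suc j))))

  det-equalRows01 : ∀ {n} (A : Matrix R (suc (suc n))) → (∀ j → A zero j ≈ A (suc zero) j) → det R A ≈ 0#
  det-equalRows01 A eq = trans (sym (det-transpose A)) (det-equalColumns01 (transpose R A) eq)

  module _ {n} (A : Matrix R (suc (suc n))) where

    rows01≔ : (x y : Fin (suc (suc n)) → Carrier) → Matrix R (suc (suc n))
    rows01≔ x y zero          = x
    rows01≔ x y (suc zero)    = y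
    rows01≔ x y (suc (suc i)) = A (suc (suc i))

    private
      d : (x y : Fin (suc (suc n)) → Carrier) → Carrier
      d x y = det R (rows01≔ x y)

      d-row0 : ∀ x y z → det R (rows01≔ x y [ zero ]≔ z) ≈ d z y
      d-row0 x y z = det-cong {A = rows01≔ x y [ zero ]≔ z} {B = rows01≔ z y}
        (λ { zero j → refl ; (suc zero) j → refl ; (suc (suc i)) j → refl })

      d-row1 : ∀ x y z → det R (rows01≔ x y [ suc zero ]≔ z) ≈ d x z
      d-row1 x y z = det-cong {A = rows01≔ x y [ suc zero ]≔ z} {B = rows01≔ x z}
        (λ { zero j → refl ; (suc zero) j → refl ; (suc (suc i)) j → refl })

      d-+ˡ : ∀ x x′ y → d (λ j → x j + x′ j) y ≈ d x y + d x′ y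
      d-+ˡ x x′ y = begin
        d (λ j → x j + x′ j) y
          ≈⟨ d-row0 x y (λ j → x j + x′ j) ⟨
        det R (rows01≔ x y [ zero ]≔ (λ j → x j + x′ j))
          ≈⟨ det-[]≔-+ (rows01≔ x y) zero x x′ ⟩
        det R (rows01≔ x y [ zero ]≔ x) + det R (rows01≔ x y [ zero ]≔ x′)
          ≈⟨ +-cong (d-row0 x y x) (d-row0 x y x′) ⟩
        d x y + d x′ y ∎

      d-+ʳ : ∀ x y y′ → d x (λ j → y j + y′ j) ≈ d x y + d x y′
      d-+ʳ x y y′ = begin
        d x (λ j → y j + y′ j)
          ≈⟨ d-row1 x y (λ j → y j + y′ j) ⟨
        det R (rows01≔ x y [ suc zero ]≔ (λ j → y j + y′ j))
          ≈⟨ det-[]≔-+ (rows01≔ x y) (suc zero) y y′ ⟩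
        det R (rows01≔ x y [ suc zero ]≔ y) + det R (rows01≔ x y [ suc zero ]≔ y′)
          ≈⟨ +-cong (d-row1 x y y) (d-row1 x y y′) ⟩
        d x y + d x y′ ∎

      d-diag : ∀ x → d x x ≈ 0#
      d-diag x = det-equalRows01 (rows01≔ x x) (λ j → refl)

    det-swap01 : det R (rows01≔ (A (suc zero)) (A zero)) ≈ - det R A
    det-swap01 = begin
      d Y X                      ≈⟨ solve 2 (λ e f → e := (f :+ e) :- f) refl (d Y X) (d X Y) ⟩
      (d X Y + d Y X) - d X Y    ≈⟨ +-cong X+Y (-‿cong (det-cong {A = rows01≔ X Y} {B = A}
                                      (λ { zero j → refl ; (suc zero) j → refl ; (suc (suc i)) j → refl }))) ⟩
      0# - det R A               ≈⟨ +-identityˡ _ ⟩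
      - det R A                  ∎
      where
      X = A zero
      Y = A (suc zero)
      S = λ j → X j + Y j
      X+Y : d X Y + d Y X ≈ 0#
      X+Y = begin
        d X Y + d Y X                       ≈⟨ +-cong (+-identityˡ _) (+-identityʳ _) ⟨
        (0# + d X Y) + (d Y X + 0#)         ≈⟨ +-cong (+-congʳ (d-diag X)) (+-congˡ (d-diag Y)) ⟨
        (d X X + d X Y) + (d Y X + d Y Y)   ≈⟨ +-cong (d-+ʳ X X Y) (d-+ʳ Y X Y) ⟨
        d X S + d Y S                       ≈⟨ d-+ˡ X Y S ⟨
        d S S                               ≈⟨ d-diag S ⟩
        0#                                  ∎

  det-equalRows : ∀ {n} (A : Matrix R n) {p q} → p ≢ q → (∀ j → A p j ≈ A q j) → det R A ≈ 0#
  det-equalRows-tail : ∀ {n} (A : Matrix R (suc n)) {p q : Fin n} → p ≢ q →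
                       (∀ j → A (suc p) j ≈ A (suc q) j) → det R A ≈ 0#
  det-equalRows-head : ∀ {n} (A : Matrix R (suc n)) q → (∀ j → A zero j ≈ A (suc q) j) → det R A ≈ 0#

  det-equalRows {suc n} A {zero}  {zero}  p≢q eq = contradiction ≡.refl p≢q
  det-equalRows {suc n} A {zero}  {suc q} p≢q eq = det-equalRows-head A q eq
  det-equalRows {suc n} A {suc p} {zero}  p≢q eq = det-equalRows-head A p (sym ∘ eq)
  det-equalRows {suc n} A {suc p} {suc q} p≢q eq = det-equalRows-tail A (p≢q ∘ ≡.cong suc) eq

  det-equalRows-tail A p≢q eq = trans (reflexive (det-expand A)) (sum-zero (λ j →
    trans (sign-resp ≈-congruence (toℕ j) (trans (*-congˡ {A zero j} (det-equalRows (minor A j) p≢q (eq ∘ punchIn j)))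
                                                 (zeroʳ _)))
          (sign-zero (toℕ j))))

  det-equalRows-head A zero eq = det-equalRows01 A eq
  -- Swapping rows 0 and 1 moves the pair of equal rows below row 0.
  det-equalRows-head {suc n} A (suc q) eq = begin
    det R A                                       ≈⟨ -‿involutive _ ⟨
    - - det R A                                   ≈⟨ -‿cong (det-swap01 A) ⟨
    - det R (rows01≔ A (A (suc zero)) (A zero))   ≈⟨ -‿cong (det-equalRows-tail (rows01≔ A (A (suc zero)) (A zero))
                                                                                {zero} {suc q} (λ ()) eq) ⟩
    - 0#                                          ≈⟨ -0#≈0# ⟩
    0#                                            ∎

  det-[]≔-equal : ∀ (A : Matrix R n) {p r} → p ≢ r → det R (A [ p ]≔ A r) ≈ 0#
  det-[]≔-equal A {p} {r} p≢r = det-equalRows (A [ p ]≔ A r) p≢r (λ j → reflexive (≡.cong-app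
    (≡.trans ([]≔-same A p (A r)) (≡.sym ([]≔-other A (A r) (p≢r ∘ ≡.sym)))) j))

  det-addRowMultiple : ∀ (A : Matrix R n) {p r} k → (p ≡ r → k ≈ 0#) →
                       det R (A [ p ]≔ (λ j → A p j + k * A r j)) ≈ det R A
  det-addRowMultiple A {p} {r} k k≈0 with p ≟ r
  ... | yes ≡.refl = trans (det-[]≔-cong A p (λ j → trans (+-congˡ (trans (*-congʳ (k≈0 ≡.refl)) (zeroˡ _))) (+-identityʳ _)))
                           (det-[]≔-self A p)
  ... | no p≢r = begin
    det R (A [ p ]≔ (λ j → A p j + k * A r j))
      ≈⟨ det-[]≔-+ A p (A p) (λ j → k * A r j) ⟩
    det R (A [ p ]≔ A p) + det R (A [ p ]≔ (λ j → k * A r j))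
      ≈⟨ +-cong (det-[]≔-self A p) (det-[]≔-* A p k (A r)) ⟩
    det R A + k * det R (A [ p ]≔ A r)
      ≈⟨ +-congˡ (trans (*-congˡ (det-[]≔-equal A p≢r)) (zeroʳ k)) ⟩
    det R A + 0#
      ≈⟨ +-identityʳ _ ⟩
    det R A ∎

  -- The coefficients c are cleared one index at a time: `supported m` treats the c that
  -- vanish from index m on.
  det-addRowMultiples : ∀ (A : Matrix R n) r (c : Fin n → Carrier) → c r ≈ 0# →
                        det R (λ s j → A s j + c s * A r j) ≈ det R A
  det-addRowMultiples {n} A r c cr≈0 = supported n ℕP.≤-refl c cr≈0 (λ s n≤s → contradiction n≤s (ℕP.<⇒≱ (toℕ<n s)))
    where
    B : (Fin n → Carrier) → Matrix R n
    B c s j = A s j + c s * A r j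

    supported : ∀ m → m ≤ n → ∀ c → c r ≈ 0# → (∀ s → m ≤ toℕ s → c s ≈ 0#) → det R (B c) ≈ det R A
    supported zero    _   c _     c≈0 = det-cong (λ s j → trans (+-congˡ (trans (*-congʳ (c≈0 s ℕ.z≤n)) (zeroˡ _))) (+-identityʳ _))
    supported (suc m) m<n c cr≈0 c≈0 = begin
      det R (B c)
        ≈⟨ det-cong B-c≈ ⟩
      det R (B c′ [ p ]≔ (λ j → B c′ p j + c p * B c′ r j))
        ≈⟨ det-addRowMultiple (B c′) (c p) (λ { ≡.refl → cr≈0 }) ⟩
      det R (B c′)
        ≈⟨ supported m (ℕP.<⇒≤ m<n) c′ c′r≈0 c′≈0 ⟩
      det R A                                                ∎
      where
      p = fromℕ< m<n
      c′ = c [ p ]≔ 0#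

      c′-other : ∀ {s} → s ≢ p → c′ s ≡ c s
      c′-other = []≔-other c 0#

      c′r≈0 : c′ r ≈ 0#
      c′r≈0 with r ≟ p
      ... | yes ≡.refl = reflexive ([]≔-same c p 0#)
      ... | no r≢p     = trans (reflexive (c′-other r≢p)) cr≈0

      c′≈0 : ∀ s → m ≤ toℕ s → c′ s ≈ 0#
      c′≈0 s m≤s with s ≟ p
      ... | yes ≡.refl = reflexive ([]≔-same c p 0#)
      ... | no s≢p     = trans (reflexive (c′-other s≢p)) (c≈0 s (ℕP.≤∧≢⇒< m≤s m≢s))
        where
        m≢s : m ≢ toℕ s
        m≢s m≡s = s≢p (toℕ-injective (≡.trans (≡.sym m≡s) (≡.sym (toℕ-fromℕ< m<n))))

      B-c′-row : ∀ {s} → c′ s ≈ 0# → ∀ j → B c′ s j ≈ A s j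
      B-c′-row c′s≈0 j = trans (+-congˡ (trans (*-congʳ c′s≈0) (zeroˡ _))) (+-identityʳ _)

      B-c≈ : ∀ s j → B c s j ≈ (B c′ [ p ]≔ (λ j → B c′ p j + c p * B c′ r j)) s j
      B-c≈ s j with s ≟ p
      ... | yes ≡.refl = begin
        A p j + c p * A r j
          ≈⟨ +-cong (B-c′-row (reflexive ([]≔-same c p 0#)) j) (*-congˡ (B-c′-row c′r≈0 j)) ⟨
        B c′ p j + c p * B c′ r j
          ≡⟨ ≡.cong-app ([]≔-same (B c′) p _) j ⟨
        (B c′ [ p ]≔ (λ j → B c′ p j + c p * B c′ r j)) p j ∎
      ... | no s≢p = begin
        A s j + c s * A r j
          ≈⟨ +-congˡ (*-congʳ (reflexive (≡.sym (c′-other s≢p)))) ⟩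
        B c′ s j
          ≡⟨ ≡.cong-app ([]≔-other (B c′) _ s≢p) j ⟨
        (B c′ [ p ]≔ (λ j → B c′ p j + c p * B c′ r j)) s j ∎

  det-addRowCombination : ∀ (A : Matrix R n) r (k : Fin n → Carrier) → k r ≈ 0# →
                          det R (A [ r ]≔ (λ j → A r j + sum (λ s → k s * A s j))) ≈ det R A
  det-addRowCombination A r k kr≈0 = begin
    det R (A [ r ]≔ (λ j → A r j + sum (λ s → k s * A s j)))
      ≈⟨ det-[]≔-+ A r (A r) (λ j → sum (λ s → k s * A s j)) ⟩
    det R (A [ r ]≔ A r) + det R (A [ r ]≔ (λ j → sum (λ s → k s * A s j)))
      ≈⟨ +-cong (det-[]≔-self A r) (det-[]≔-sum A r k A) ⟩
    det R A + sum (λ s → k s * det R (A [ r ]≔ A s))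
      ≈⟨ +-congˡ (sum-zero vanishes) ⟩
    det R A + 0#
      ≈⟨ +-identityʳ _ ⟩
    det R A ∎
    where
    vanishes : ∀ s → k s * det R (A [ r ]≔ A s) ≈ 0#
    vanishes s with s ≟ r
    ... | yes ≡.refl = trans (*-congʳ kr≈0) (zeroˡ _)
    ... | no s≢r     = trans (*-congˡ (det-[]≔-equal A (s≢r ∘ ≡.sym))) (zeroʳ _)

  elementary : Fin n → (Fin n → Carrier) → Matrix R n
  elementary r c s j = δ s j + c s * δ r j

  det-elementary : ∀ {n} r (c : Fin n → Carrier) → c r ≈ 0# → det R (elementary r c) ≈ 1#
  det-elementary {n} r c cr≈0 = trans (det-addRowMultiples δ r c cr≈0) (det-δ {n})

  -- Adding Σₛ (y r δ r s - y s) · (row s) to row r turns it into β · (row r of δ).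
  det-elementary-[]≔ : ∀ r (c : Fin n → Carrier) → c r ≈ 0# → ∀ y →
                       det R (elementary r c [ r ]≔ y) ≈ y r - sum (λ s → c s * y s)
  det-elementary-[]≔ r c cr≈0 y = begin
    det R M                              ≈⟨ det-addRowCombination M r k kr≈0 ⟨
    det R (M [ r ]≔ z)                   ≈⟨ det-cong (λ i → reflexive ∘ ≡.cong-app (updateAt-updateAt r E i)) ⟩
    det R (E [ r ]≔ z)                   ≈⟨ det-[]≔-cong E r z≈βδ ⟩
    det R (E [ r ]≔ (λ j → β * δ r j))   ≈⟨ det-[]≔-* E r β (δ r) ⟩
    β * det R (E [ r ]≔ δ r)             ≈⟨ *-congˡ (trans (det-[]≔-cong E r E-row-r) (det-[]≔-self E r)) ⟩
    β * det R E                          ≈⟨ *-congˡ (det-elementary r c cr≈0) ⟩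
    β * 1#                               ≈⟨ *-identityʳ β ⟩
    β                                    ∎
    where
    E = elementary r c
    M = E [ r ]≔ y
    Σcy = sum (λ s → c s * y s)
    β = y r - Σcy
    k = λ s → y r * δ r s - y s
    z = λ j → M r j + sum (λ s → k s * M s j)

    kr≈0 : k r ≈ 0#
    kr≈0 = trans (+-congʳ (trans (*-congˡ (δ-diag r)) (*-identityʳ _))) (-‿inverseʳ _)

    E-row-r : ∀ j → δ r j ≈ E r j
    E-row-r j = sym (trans (+-congˡ (trans (*-congʳ cr≈0) (zeroˡ _))) (+-identityʳ _))

    kM≈kE : ∀ j s → k s * M s j ≈ k s * E s j
    kM≈kE j s with s ≟ r
    ... | yes ≡.refl = trans (*-congʳ kr≈0) (trans (zeroˡ _) (sym (trans (*-congʳ kr≈0) (zeroˡ _))))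
    ... | no s≢r     = *-congˡ (reflexive (≡.cong-app ([]≔-other E y s≢r) j))

    Σkc : sum (λ s → k s * c s) ≈ - Σcy
    Σkc = begin
      sum (λ s → k s * c s)
        ≈⟨ sum-cong-≋ (λ s → solve 4 (λ yr d ys cs → (yr :* d :- ys) :* cs := yr :* (d :* cs) :+ :- (cs :* ys))
                                      refl (y r) (δ r s) (y s) (c s)) ⟩
      sum (λ s → y r * (δ r s * c s) + - (c s * y s))
        ≈⟨ ∑-distrib-+ (λ s → y r * (δ r s * c s)) (λ s → - (c s * y s)) ⟩
      sum (λ s → y r * (δ r s * c s)) + sum (λ s → - (c s * y s))
        ≈⟨ +-cong (*-distribˡ-sum (y r) (λ s → δ r s * c s)) (sym (sum-neg (λ s → c s * y s))) ⟨
      y r * sum (λ s → δ r s * c s) + - Σcy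
        ≈⟨ +-congʳ (trans (*-congˡ (trans (sum-δˡ r c) cr≈0)) (zeroʳ _)) ⟩
      0# + - Σcy
        ≈⟨ +-identityˡ _ ⟩
      - Σcy ∎

    z≈βδ : ∀ j → z j ≈ β * δ r j
    z≈βδ j = begin
      M r j + sum (λ s → k s * M s j)
        ≡⟨ ≡.cong (λ row → row j + sum (λ s → k s * M s j)) ([]≔-same E r y) ⟩
      y j + sum (λ s → k s * M s j)
        ≈⟨ +-congˡ (sum-cong-≋ (kM≈kE j)) ⟩
      y j + sum (λ s → k s * (δ s j + c s * δ r j))
        ≈⟨ +-congˡ (sum-cong-≋ (λ s → solve 4 (λ k d c e → k :* (d :+ c :* e) := k :* d :+ (k :* c) :* e)
          refl (k s) (δ s j) (c s) (δ r j))) ⟩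
      y j + sum (λ s → k s * δ s j + (k s * c s) * δ r j)
        ≈⟨ +-congˡ (∑-distrib-+ (λ s → k s * δ s j) (λ s → (k s * c s) * δ r j)) ⟩
      y j + (sum (λ s → k s * δ s j) + sum (λ s → (k s * c s) * δ r j))
        ≈⟨ +-congˡ (+-cong (sym (sum-δʳ k j)) (*-distribʳ-sum (δ r j) (λ s → k s * c s))) ⟨
      y j + (k j + sum (λ s → k s * c s) * δ r j)
        ≈⟨ +-congˡ (+-congˡ (*-congʳ Σkc)) ⟩
      y j + (k j + - Σcy * δ r j)
        ≈⟨ solve 4 (λ yj yr d S → yj :+ ((yr :* d :- yj) :+ (:- S) :* d) := (yr :- S) :* d) refl (y j) (y r) (δ r j) Σcy ⟩
      β * δ r j ∎

  det-[]≔-correction : ∀ (A : Matrix R n) r (y : Fin n → Carrier) → det R A ≈ 1# →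
                       det R (A [ r ]≔ (λ j → y j + (1# - det R (A [ r ]≔ y)) * A r j)) ≈ 1#
  det-[]≔-correction A r y detA≈1 = begin
    det R (A [ r ]≔ (λ j → y j + (1# - d) * A r j))   ≈⟨ det-[]≔-+ A r y (λ j → (1# - d) * A r j) ⟩
    d + det R (A [ r ]≔ (λ j → (1# - d) * A r j))     ≈⟨ +-congˡ (det-[]≔-* A r (1# - d) (A r)) ⟩
    d + (1# - d) * det R (A [ r ]≔ A r)               ≈⟨ +-congˡ (*-congˡ (trans (det-[]≔-self A r) detA≈1)) ⟩
    d + (1# - d) * 1#                                 ≈⟨ solve 1 (λ d → d :+ (:1 :- d) :* :1 := :1) refl d ⟩
    1#                                                ∎
    where
    d = det R (A [ r ]≔ y)

module Ideals {c ℓ : Level} (R : CommutativeRing c ℓ) where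
  open CommutativeRing R hiding (zero)
  open Congruences R
  open Sums R
  open IntegerCoefficients R using (solve; _:=_; _:+_; _:*_; :-_; _:-_; :0; :1)
  open SetoidReasoning setoid

  Whole-isIdeal : IsIdeal R (Whole R)
  Whole-isIdeal = record { resp = λ _ _ → tt ; zero∈ = tt ; +∈ = λ _ _ → tt ; *∈ = λ _ _ → tt }

  Prod-isIdeal : ∀ {M J : Subset R} → IsIdeal R M → IsIdeal R (Prod R M J)
  Prod-isIdeal {M} {J} M-isIdeal = record { resp = ·-resp ; zero∈ = ·-zero ; +∈ = ·-add ; *∈ = *∈ }
    where
    *∈ : ∀ r {x} → Prod R M J x → Prod R M J (r * x)
    *∈ r (·-gen {a} {b} a∈M b∈J) = ·-resp (*-assoc r a b) (·-gen (IsIdeal.*∈ M-isIdeal r a∈M) b∈J)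
    *∈ r ·-zero                  = ·-resp (sym (zeroʳ r)) ·-zero
    *∈ r (·-add {x} {y} x∈ y∈)   = ·-resp (sym (distribˡ r x y)) (·-add (*∈ r x∈) (*∈ r y∈))
    *∈ r (·-resp x≈y x∈)         = ·-resp (*-congˡ x≈y) (*∈ r x∈)

  prodList-isIdeal : ∀ {Ms} → All (IsMaximal R) Ms → IsIdeal R (prodList R Ms)
  prodList-isIdeal []                        = Whole-isIdeal
  prodList-isIdeal ((M-isIdeal , _ , _) ∷ _) = Prod-isIdeal M-isIdeal

  ≐-isIdeal : ∀ {I J : Subset R} → _≐_ R I J → IsIdeal R J → IsIdeal R I
  ≐-isIdeal (I⊆J , J⊆I) J-isIdeal = record
    { resp  = λ x≈y x∈I → J⊆I _ (resp x≈y (I⊆J _ x∈I))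
    ; zero∈ = J⊆I _ zero∈
    ; +∈    = λ x∈I y∈I → J⊆I _ (+∈ (I⊆J _ x∈I) (I⊆J _ y∈I))
    ; *∈    = λ r x∈I → J⊆I _ (*∈ r (I⊆J _ x∈I)) }
    where open IsIdeal J-isIdeal

  UnitMod : Subset R → Carrier → Set (c ⊔ ℓ)
  UnitMod I x = ∃ λ w → w * x ∼ 1# mod I

  UnitMod-⊆ : ∀ {I J : Subset R} → _⊆_ R I J → ∀ {x} → UnitMod I x → UnitMod J x
  UnitMod-⊆ I⊆J (w , wx∼1) = w , I⊆J _ wx∼1

  UnitMod-resp : ∀ {I : Subset R} → IsIdeal R I → ∀ {x y} → x ∼ y mod I → UnitMod I x → UnitMod I y
  UnitMod-resp I-isIdeal {x} {y} x∼y (w , wx∼1) =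
    w , resp (solve 3 (λ w x y → (w :* x :- :1) :- w :* (x :- y) := w :* y :- :1) refl w x y) (-∈ wx∼1 (*∈ w x∼y))
    where open Ideal I-isIdeal

  UnitMod-Prod : ∀ {M J : Subset R} → IsIdeal R M → ∀ {x} →
                 UnitMod M x → UnitMod J x → UnitMod (Prod R M J) x
  UnitMod-Prod M-isIdeal {x} (w₁ , w₁x∼1) (w₂ , w₂x∼1) =
    w₁ + w₂ - w₁ * w₂ * x ,
    ·-resp (solve 3 (λ w₁ w₂ x → (:- (w₁ :* x :- :1)) :* (w₂ :* x :- :1) := (w₁ :+ w₂ :- w₁ :* w₂ :* x) :* x :- :1)
                    refl w₁ w₂ x)
           (·-gen (Ideal.-‿∈ M-isIdeal w₁x∼1) w₂x∼1)

  maximal-dichotomy : ∀ {M : Subset R} → IsMaximal R M → ∀ x → M x ⊎ UnitMod M x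
  maximal-dichotomy {M} (M-isIdeal , _ , maximal) x with maximal M+Rx M+Rx-isIdeal M⊆M+Rx
    where
    open IsIdeal M-isIdeal
    M+Rx : Subset R
    M+Rx y = ∃ λ m → ∃ λ a → M m × y ≈ m + a * x
    M+Rx-isIdeal : IsIdeal R M+Rx
    M+Rx-isIdeal = record
      { resp  = λ { y≈z (m , a , m∈M , y≈) → m , a , m∈M , trans (sym y≈z) y≈ }
      ; zero∈ = 0# , 0# , zero∈ , solve 1 (λ x → :0 := :0 :+ :0 :* x) refl x
      ; +∈    = λ { (m , a , m∈M , y≈) (m′ , a′ , m′∈M , z≈) → m + m′ , a + a′ , +∈ m∈M m′∈M ,
                    trans (+-cong y≈ z≈) (solve 5 (λ m a m′ a′ x → (m :+ a :* x) :+ (m′ :+ a′ :* x) := (m :+ m′) :+ (a :+ a′) :* x)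
                                                  refl m a m′ a′ x) }
      ; *∈    = λ { b (m , a , m∈M , y≈) → b * m , b * a , *∈ b m∈M ,
                    trans (*-congˡ y≈) (solve 4 (λ b m a x → b :* (m :+ a :* x) := b :* m :+ (b :* a) :* x) refl b m a x) } }
    M⊆M+Rx : _⊆_ R M M+Rx
    M⊆M+Rx y y∈M = y , 0# , y∈M , solve 2 (λ y x → y := y :+ :0 :* x) refl y x
  ... | inj₁ (m , a , m∈M , 1≈m+ax) = inj₂ (a , IsIdeal.resp M-isIdeal
          (trans (solve 2 (λ m ax → :- m := ax :- (m :+ ax)) refl m (a * x)) (+-congˡ (-‿cong (sym 1≈m+ax))))
          (Ideal.-‿∈ M-isIdeal m∈M))
  ... | inj₂ M+Rx⊆M = inj₁ (M+Rx⊆M x (0# , 1# , IsIdeal.zero∈ M-isIdeal , solve 1 (λ x → x := :0 :+ :1 :* x) refl x))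

  Adapted : ∀ {n} → Subset R → (Fin n → Carrier) → Fin n → (Fin n → Carrier) → Set (c ⊔ ℓ)
  Adapted I v r t = t r ≈ 1# × UnitMod I (dot t v)

  -- If t·v ∈ M, add d·(ρ - ρ r · t) to t, where ρ·v = 1 and d = 1 - w (t·v) ∈ J:
  -- this keeps t·v modulo J and makes it ≡ d ≡ 1 modulo M.
  Adapted-Prod : ∀ {n} {M J : Subset R} → IsMaximal R M → IsIdeal R J →
                 ∀ {v : Fin n → Carrier} → Unital R v →
                 ∀ {r t} → Adapted J v r t → ∃ λ t′ → Adapted (Prod R M J) v r t′
  Adapted-Prod {M = M} {J} M-isMaximal@(M-isIdeal , _) J-isIdeal {v} (ρ , ρ·v≈1) {r} {t} (tr≈1 , uJ@(w , wT∼1))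
    with maximal-dichotomy M-isMaximal (dot t v)
  ... | inj₂ uM  = t , tr≈1 , UnitMod-Prod M-isIdeal uM uJ
  ... | inj₁ T∈M = t′ , t′r≈1 , UnitMod-Prod M-isIdeal (1# , T′∼1-mod-M) (UnitMod-resp J-isIdeal T∼T′-mod-J uJ)
    where
    T = dot t v
    d = 1# - w * T
    s = λ i → 1# * ρ i + (- ρ r) * t i
    t′ = λ i → 1# * t i + d * s i

    t′r≈1 : t′ r ≈ 1#
    t′r≈1 = begin
      1# * t r + d * (1# * ρ r + (- ρ r) * t r)
        ≈⟨ +-cong (*-congˡ tr≈1) (*-congˡ (+-congˡ (*-congˡ tr≈1))) ⟩
      1# * 1# + d * (1# * ρ r + (- ρ r) * 1#)
        ≈⟨ solve 2 (λ d p → :1 :* :1 :+ d :* (:1 :* p :+ (:- p) :* :1) := :1) refl d (ρ r) ⟩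
      1#                                          ∎

    T′≈ : dot t′ v ≈ T + d * (1# - ρ r * T)
    T′≈ = begin
      dot t′ v
        ≈⟨ dot-linear 1# d t s v ⟩
      1# * T + d * dot s v
        ≈⟨ +-congˡ (*-congˡ (dot-linear 1# (- ρ r) ρ t v)) ⟩
      1# * T + d * (1# * dot ρ v + (- ρ r) * T)
        ≈⟨ +-congˡ (*-congˡ (+-congʳ (*-congˡ ρ·v≈1′))) ⟩
      1# * T + d * (1# * 1# + (- ρ r) * T)
        ≈⟨ solve 3 (λ T d p → :1 :* T :+ d :* (:1 :* :1 :+ (:- p) :* T) := T :+ d :* (:1 :- p :* T))
          refl T d (ρ r) ⟩
      T + d * (1# - ρ r * T)                      ∎
      where
      ρ·v≈1′ : dot ρ v ≈ 1#
      ρ·v≈1′ = trans (reflexive (≡.sym (∑≡sum (λ i → ρ i * v i)))) ρ·v≈1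

    T∼T′-mod-J : T ∼ dot t′ v mod J
    T∼T′-mod-J = IsIdeal.resp J-isIdeal
      (trans (solve 3 (λ w T p → (w :* T :- :1) :* (:1 :- p :* T) := T :- (T :+ (:1 :- w :* T) :* (:1 :- p :* T))) refl w T (ρ r))
             (+-congˡ (-‿cong (sym T′≈))))
      (Ideal.*∈ʳ J-isIdeal _ wT∼1)

    T′∼1-mod-M : 1# * dot t′ v ∼ 1# mod M
    T′∼1-mod-M = IsIdeal.resp M-isIdeal
      (trans (solve 3 (λ w T p → T :* (:1 :- w :- p :+ w :* p :* T) := :1 :* (T :+ (:1 :- w :* T) :* (:1 :- p :* T)) :- :1)
                      refl w T (ρ r))
             (+-congʳ (*-congˡ (sym T′≈))))
      (Ideal.*∈ʳ M-isIdeal _ T∈M)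

  Adapted-prodList : ∀ {n} {Ms} → All (IsMaximal R) Ms → ∀ {v : Fin n → Carrier} → Unital R v →
                     ∀ r → ∃ λ t → Adapted (prodList R Ms) v r t
  Adapted-prodList []                       v-unital r = δ r , δ-diag r , 1# , tt
  Adapted-prodList (M-isMaximal ∷ Ms-isMax) v-unital r =
    Adapted-Prod M-isMaximal (prodList-isIdeal Ms-isMax) v-unital (proj₂ (Adapted-prodList Ms-isMax v-unital r))

module Construction {c ℓ : Level} (R : CommutativeRing c ℓ) where
  open CommutativeRing R hiding (zero)
  open Congruences R
  open Sums R
  open Determinants R
  open Ideals R
  open IntegerCoefficients R using (solve; _:=_; _:+_; _:*_; :-_; _:-_; :0; :1)

  product : ∀ {n} → (Fin n → Carrier) → Carrier
  product = foldr _*_ 1#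

  product-∈ : ∀ {I : Subset R} → IsIdeal R I → ∀ {n} (f : Fin n → Carrier) s → I (f s) → I (product f)
  product-∈ I-isIdeal f zero    f0∈I = Ideal.*∈ʳ I-isIdeal _ f0∈I
  product-∈ I-isIdeal f (suc s) fs∈I = IsIdeal.*∈ I-isIdeal (f zero) (product-∈ I-isIdeal (f ∘ suc) s fs∈I)

  product-∼1 : ∀ {I : Subset R} → IsIdeal R I → ∀ {n} (f : Fin n → Carrier) →
               (∀ s → f s ∼ 1# mod I) → product f ∼ 1# mod I
  product-∼1 I-isIdeal {zero}  f f∼1 = Ideal.∼-refl I-isIdeal
  product-∼1 I-isIdeal {suc n} f f∼1 =
    ∼-trans (*-resp (f∼1 zero) (product-∼1 I-isIdeal (f ∘ suc) (f∼1 ∘ suc))) (≈⇒∼ (*-identityˡ 1#))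
    where open Ideal I-isIdeal

  module _ {k} {I : Fin k → Subset R} (I-isIdeal : ∀ r → IsIdeal R (I r))
           (comaximal : ∀ i j → i ≢ j → Comaximal R (I i) (I j)) where

    private
      factor : Fin k → Fin k → Carrier
      factor r s with s ≟ r
      ... | yes _  = 1#
      ... | no s≢r = proj₁ (proj₂ (comaximal r s (s≢r ∘ ≡.sym)))

      factor-∼1 : ∀ r s → factor r s ∼ 1# mod I r
      factor-∼1 r s with s ≟ r
      ... | yes _  = Ideal.∼-refl (I-isIdeal r)
      ... | no s≢r with comaximal r s (s≢r ∘ ≡.sym)
      ...   | a , b , a∈Ir , _ , a+b≈1 = IsIdeal.resp (I-isIdeal r)
              (trans (solve 2 (λ a b → :- a := b :- (a :+ b)) refl a b) (+-congˡ (-‿cong a+b≈1)))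
              (Ideal.-‿∈ (I-isIdeal r) a∈Ir)

      factor-∈ : ∀ r s → s ≢ r → I s (factor r s)
      factor-∈ r s s≢r with s ≟ r
      ... | yes s≡r  = contradiction s≡r s≢r
      ... | no s≢r′ = proj₁ (proj₂ (proj₂ (proj₂ (comaximal r s (s≢r′ ∘ ≡.sym)))))

    crtBasis : ∀ r → ∃ λ e → e ∼ 1# mod I r × (∀ q → q ≢ r → I q e)
    crtBasis r = product (factor r) , product-∼1 (I-isIdeal r) (factor r) (factor-∼1 r) ,
                 λ q q≢r → product-∈ (I-isIdeal q) (factor r) q (factor-∈ r q q≢r)

  -- Modulo I, A′ ≡ elementary r u and x ≡ w·v, so f x ≡ w (t·v) ≡ 1; modulo an ideal
  -- containing ε, A′ ≡ A and x ≡ A′ r, so again f x ≡ 1.  In both cases row r of A″ ≡ x.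
  module RowStep {n} {I : Subset R} (I-isIdeal : IsIdeal R I)
                 {r : Fin n} {v t : Fin n → Carrier} (t-adapted : Adapted I v r t)
                 {ε : Carrier} (ε∼1 : ε ∼ 1# mod I)
                 (A : Matrix R n) (detA≈1 : det R A ≈ 1#) (A∼δ : ∀ i j → A i j ∼ δ i j mod I) where

    w : Carrier
    w = proj₁ (proj₂ t-adapted)

    private
      tr≈1 : t r ≈ 1#
      tr≈1 = proj₁ t-adapted

      w·t·v∼1 : w * dot t v ∼ 1# mod I
      w·t·v∼1 = proj₂ (proj₂ t-adapted)

    u : Fin n → Carrier
    u s = δ r s - t s

    A′ : Matrix R n
    A′ s j = A s j + (ε * u s) * A r j

    f : (Fin n → Carrier) → Carrier
    f y = det R (A′ [ r ]≔ y)

    x : Fin n → Carrier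
    x j = A′ r j + ε * (w * v j - A′ r j)

    A″ : Matrix R n
    A″ = A′ [ r ]≔ (λ j → x j + (1# - f x) * A′ r j)

    u-r : u r ≈ 0#
    u-r = trans (+-cong (δ-diag r) (-‿cong tr≈1)) (-‿inverseʳ 1#)

    det-A′ : det R A′ ≈ 1#
    det-A′ = trans (det-addRowMultiples A r (λ s → ε * u s) (trans (*-congˡ u-r) (zeroʳ ε))) detA≈1

    det-A″ : det R A″ ≈ 1#
    det-A″ = det-[]≔-correction A′ r x det-A′

    det-elementary-u : ∀ y → det R (elementary r u [ r ]≔ y) ≈ dot t y
    det-elementary-u y = begin
      det R (elementary r u [ r ]≔ y)
        ≈⟨ det-elementary-[]≔ r u u-r y ⟩
      y r - sum (λ s → u s * y s)
        ≈⟨ +-congˡ (-‿cong (sum-cong-≋ (λ s → solve 3 (λ d t y → (d :- t) :* y := d :* y :+ :- (t :* y))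
                                                        refl (δ r s) (t s) (y s)))) ⟩
      y r - sum (λ s → δ r s * y s + - (t s * y s))
        ≈⟨ +-congˡ (-‿cong (∑-distrib-+ (λ s → δ r s * y s) (λ s → - (t s * y s)))) ⟩
      y r - (sum (λ s → δ r s * y s) + sum (λ s → - (t s * y s)))
        ≈⟨ +-congˡ (-‿cong (+-cong (sum-δˡ r y) (sum-neg (λ s → t s * y s)))) ⟩
      y r - (y r + - dot t y)
        ≈⟨ solve 2 (λ a T → a :- (a :+ :- T) := T) refl (y r) (dot t y) ⟩
      dot t y ∎
      where open SetoidReasoning setoid

    A″-other : ∀ {J : Subset R} → IsIdeal R J → J ε → ∀ i j → A″ i j ∼ A i j mod J
    A″-other {J} J-isIdeal ε∈J i j = ≡.subst (λ a → A″ i j ∼ a mod J) (≡.cong-app ([]≔-self A r i) j)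
      ([]≔-resp congruence A′ A r row-r (λ s _ → A′∼A s) i j)
      where
      open Ideal J-isIdeal
      open SetoidReasoning ∼-setoid

      A′∼A : ∀ s j → A′ s j ∼ A s j mod J
      A′∼A s j = resp (solve 2 (λ a e → e := (a :+ e) :- a) refl (A s j) ((ε * u s) * A r j))
                      (*∈ʳ (A r j) (*∈ʳ (u s) ε∈J))

      x∼A′r : ∀ j → x j ∼ A′ r j mod J
      x∼A′r j = resp (solve 2 (λ a e → e := (a :+ e) :- a) refl (A′ r j) (ε * (w * v j - A′ r j)))
                     (*∈ʳ _ ε∈J)

      fx∼1 : f x ∼ 1# mod J
      fx∼1 = begin
        f x        ≈⟨ det-resp congruence ([]≔-resp congruence A′ A′ r x∼A′r (λ _ _ _ → ∼-refl)) ⟩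
        f (A′ r)   ≈⟨ ≈⇒∼ (trans (det-[]≔-self A′ r) det-A′) ⟩
        1#         ∎

      row-r : ∀ j → x j + (1# - f x) * A′ r j ∼ A r j mod J
      row-r j = begin
        x j + (1# - f x) * A′ r j     ≈⟨ +-resp (x∼A′r j) (*-resp (+-resp ∼-refl (-‿resp fx∼1)) ∼-refl) ⟩
        A′ r j + (1# - 1#) * A′ r j   ≈⟨ ≈⇒∼ (solve 1 (λ a → a :+ (:1 :- :1) :* a := a) refl (A′ r j)) ⟩
        A′ r j                        ≈⟨ A′∼A r j ⟩
        A r j                         ∎

    A″-row : ∀ j → A″ r j ∼ w * v j mod I
    A″-row j = ≡.subst (λ a → a ∼ w * v j mod I) (≡.sym (≡.cong-app ([]≔-same A′ r _) j)) (begin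
      x j + (1# - f x) * A′ r j      ≈⟨ +-resp (x∼wv j) (*-resp (+-resp ∼-refl (-‿resp fx∼1)) ∼-refl) ⟩
      w * v j + (1# - 1#) * A′ r j   ≈⟨ ≈⇒∼ (solve 2 (λ b a → b :+ (:1 :- :1) :* a := b) refl (w * v j) (A′ r j)) ⟩
      w * v j                        ∎)
      where
      open Ideal I-isIdeal
      open SetoidReasoning ∼-setoid

      x∼wv : ∀ j → x j ∼ w * v j mod I
      x∼wv j = begin
        A′ r j + ε * (w * v j - A′ r j)
          ≈⟨ +-resp ∼-refl (*-resp ε∼1 ∼-refl) ⟩
        A′ r j + 1# * (w * v j - A′ r j)
          ≈⟨ ≈⇒∼ (solve 2 (λ a b → a :+ :1 :* (b :- a) := b) refl (A′ r j) (w * v j)) ⟩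
        w * v j                            ∎

      A′∼E : ∀ s j → A′ s j ∼ elementary r u s j mod I
      A′∼E s j = begin
        A s j + (ε * u s) * A r j   ≈⟨ +-resp (A∼δ s j) (*-resp (*-resp ε∼1 ∼-refl) (A∼δ r j)) ⟩
        δ s j + (1# * u s) * δ r j  ≈⟨ ≈⇒∼ (+-congˡ (*-congʳ (*-identityˡ (u s)))) ⟩
        δ s j + u s * δ r j         ∎

      fx∼1 : f x ∼ 1# mod I
      fx∼1 = begin
        f x
          ≈⟨ det-resp congruence ([]≔-resp congruence A′ A′ r x∼wv (λ _ _ _ → ∼-refl)) ⟩
        f (λ j → w * v j)
          ≈⟨ ≈⇒∼ (det-[]≔-* A′ r w v) ⟩
        w * f v
          ≈⟨ *-resp ∼-refl (det-resp congruence
            ([]≔-resp congruence A′ (elementary r u) r (λ _ → ∼-refl) (λ s _ → A′∼E s))) ⟩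
        w * det R (elementary r u [ r ]≔ v)
          ≈⟨ ≈⇒∼ (*-congˡ (det-elementary-u v)) ⟩
        w * dot t v
          ≈⟨ w·t·v∼1 ⟩
        1#                                   ∎

  module Realisation {k} {I : Fin k → Subset R} (I-isIdeal : ∀ r → IsIdeal R (I r))
                     (comaximal : ∀ i j → i ≢ j → Comaximal R (I i) (I j))
                     (v : Fin k → Fin k → Carrier)
                     (adapted : ∀ r → ∃ λ t → Adapted (I r) (v r) r t) where

    Realised : Matrix R k → Fin k → Set (c ⊔ ℓ)
    Realised A r = ∃ λ λᵣ → ∀ j → A r j ∼ λᵣ * v r j mod I r

    Pristine : Matrix R k → Fin k → Set (c ⊔ ℓ)
    Pristine A r = ∀ i j → A i j ∼ δ i j mod I r

    Invariant : ℕ → Matrix R k → Set (c ⊔ ℓ)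
    Invariant m A = det R A ≈ 1# × (∀ r → toℕ r < m → Realised A r) × (∀ r → m ≤ toℕ r → Pristine A r)

    realise : ∀ m → m ≤ k → ∃ (Invariant m)
    realise zero    _   = δ , det-δ {k} , (λ _ ()) , (λ r _ i j → Ideal.∼-refl (I-isIdeal r))
    realise (suc m) m<k with realise m (ℕP.<⇒≤ m<k)
    ... | A , detA≈1 , realised , pristine = A″ , det-A″ , realised′ , pristine′
      where
      r = fromℕ< m<k
      toℕ-r : toℕ r ≡ m
      toℕ-r = toℕ-fromℕ< m<k
      e = crtBasis I-isIdeal comaximal r
      open RowStep (I-isIdeal r) (proj₂ (adapted r)) (proj₁ (proj₂ e)) A detA≈1
                   (pristine r (ℕP.≤-reflexive (≡.sym toℕ-r)))

      A″∼A : ∀ q → q ≢ r → ∀ i j → A″ i j ∼ A i j mod I q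
      A″∼A q q≢r = A″-other (I-isIdeal q) (proj₂ (proj₂ e) q q≢r)

      realised′ : ∀ q → toℕ q < suc m → Realised A″ q
      realised′ q q<1+m with q ≟ r
      ... | yes ≡.refl = w , A″-row
      ... | no q≢r with realised q (ℕP.≤∧≢⇒< (ℕ.s≤s⁻¹ q<1+m) (q≢r ∘ toℕ-injective ∘ (λ q≡m → ≡.trans q≡m (≡.sym toℕ-r))))
      ...   | λq , Aq∼λqvq = λq , λ j → Ideal.∼-trans (I-isIdeal q) (A″∼A q q≢r q j) (Aq∼λqvq j)

      pristine′ : ∀ q → suc m ≤ toℕ q → Pristine A″ q
      pristine′ q 1+m≤q i j = Ideal.∼-trans (I-isIdeal q) (A″∼A q q≢r i j) (pristine q (ℕP.<⇒≤ 1+m≤q) i j)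
        where
        q≢r : q ≢ r
        q≢r q≡r = ℕP.<-irrefl (≡.trans (≡.sym toℕ-r) (≡.cong toℕ (≡.sym q≡r))) 1+m≤q

    Realised⇒ProjEq : ∀ {A r} → Realised A r → ProjEq R (I r) (A r) (v r)
    Realised⇒ProjEq {A} {r} (λᵣ , Ar∼λᵣvr) i j _ = ∼0⇒∈ (begin
      A r i * v r j - A r j * v r i
        ≈⟨ +-resp (*-resp (Ar∼λᵣvr i) ∼-refl) (-‿resp (*-resp (Ar∼λᵣvr j) ∼-refl)) ⟩
      λᵣ * v r i * v r j - λᵣ * v r j * v r i
        ≈⟨ ≈⇒∼ (solve 3 (λ l a b → l :* a :* b :- l :* b :* a := :0) refl λᵣ (v r i) (v r j)) ⟩
      0# ∎)
      where
      open Ideal (I-isIdeal r)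
      open SetoidReasoning ∼-setoid

    realisingMatrix : ∃ λ A → det R A ≈ 1# × ∀ r → ProjEq R (I r) (A r) (v r)
    realisingMatrix with realise k ℕP.≤-refl
    ... | A , detA≈1 , realised , _ = A , detA≈1 , λ r → Realised⇒ProjEq {A} (realised r (toℕ<n r))

mainTheorem3 : ∀ {c ℓ : Level} (R : CommutativeRing c ℓ) → DedekindType R →
    (k : ℕ) → 2 ≤ k →
    (I : Fin k → Subset R) → (∀ i → InMR R (I i)) →
    (∀ i j → i ≢ j → Comaximal R (I i) (I j)) →
      -- σ₁ (rows) is surjective
      ((v : Fin k → Fin k → CommutativeRing.Carrier R) → (∀ i → Unital R (v i)) →
        Σ (Matrix R k) λ A → CommutativeRing._≈_ R (det R A) (CommutativeRing.1# R)
          × (∀ i → ProjEq R (I i) (A i) (v i)))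
    × -- σ₂ (columns) is surjective
      ((v : Fin k → Fin k → CommutativeRing.Carrier R) → (∀ i → Unital R (v i)) →
        Σ (Matrix R k) λ A → CommutativeRing._≈_ R (det R A) (CommutativeRing.1# R)
          × (∀ i → ProjEq R (I i) (transpose R A i) (v i)))
mainTheorem3 R _ k _ I I∈M comaximal = rows , columns
  where
  open CommutativeRing R using (Carrier; _≈_; 1#; trans)
  open Construction R
  open Ideals R
  open Determinants R using (det-transpose)

  I-isIdeal : ∀ r → IsIdeal R (I r)
  I-isIdeal r with I∈M r
  ... | _ , Ms-maximal , I≐Ms = ≐-isIdeal I≐Ms (prodList-isIdeal Ms-maximal)

  adapted : ∀ (v : Fin k → Fin k → Carrier) → (∀ i → Unital R (v i)) → ∀ r → ∃ λ t → Adapted (I r) (v r) r t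
  adapted v v-unital r with I∈M r
  ... | _ , Ms-maximal , (_ , Ms⊆I) with Adapted-prodList Ms-maximal (v-unital r) r
  ...   | t , tr≈1 , unit = t , tr≈1 , UnitMod-⊆ Ms⊆I unit

  rows : (v : Fin k → Fin k → Carrier) → (∀ i → Unital R (v i)) →
         ∃ λ A → det R A ≈ 1# × ∀ i → ProjEq R (I i) (A i) (v i)
  rows v v-unital = Realisation.realisingMatrix I-isIdeal comaximal v (adapted v v-unital)

  columns : (v : Fin k → Fin k → Carrier) → (∀ i → Unital R (v i)) →
            ∃ λ A → det R A ≈ 1# × ∀ i → ProjEq R (I i) (transpose R A i) (v i)
  columns v v-unital =
    let A , detA≈1 , A-realises = rows v v-unital
    in  transpose R A , trans (det-transpose A) detA≈1 , A-realises
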